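{- If $G$ is a connected graph of order $n\ge 3$, then $\eta_p(G)\le n-{\rm diam}(G)+2$. Moreover, this bound is attained by the path $P_n$ and by the star $K_{1,n-1}$.
   Context: Graphs are finite, simple, undirected and connected; ${\rm diam}(G)$ is the diameter. For $v\in V(G)$, $S\subseteq V(G)$: $d(v,S)=\min\{d(v,w):w\in S\}$. For a partition $\Pi=\{S_1,\dots,S_k\}$ of $V(G)$, $r(u|\Pi)=(d(u,S_1),\dots,d(u,S_k))$; $\Pi$ is resolving if $r(u|\Pi)\ne r(v|\Pi)$ for all distinct $u,v$, and dominating if each vertex $v$ has $d(v,S_j)=1$ for some $j$. $\eta_p(G)$ is the minimum cardinality of a partition that is both resolving and dominating. -}

module Defs where

open import Data.Nat using (ℕ; zero; suc; _+_; _⊓_; _⊔_; _≤_)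
open import Data.Nat.Properties using (1+n≢n) renaming (_≟_ to _≟ℕ_)
open import Data.Fin using (Fin; toℕ) renaming (zero to fzero; suc to fsuc)
open import Data.Fin.Properties using () renaming (_≟_ to _≟F_)
open import Data.Bool using (Bool; true; false; if_then_else_; _∧_)
open import Data.List using (List; foldr)
open import Data.Bool.ListAction using (any)
open import Data.List.Base using (allFin)
open import Data.Vec using (Vec; tabulate)
open import Data.Product using (Σ; ∃-syntax; _×_; _,_)
open import Data.Sum using (_⊎_; inj₁; inj₂; [_,_])
open import Data.Unit using (⊤; tt)
open import Data.Empty using (⊥)
open import Relation.Nullary using (¬_; Dec; yes; no; does)
open import Relation.Nullary.Decidable using (_⊎-dec_)
open import Relation.Binary.PropositionalEquality using (_≡_; _≢_; refl; sym)

record Graph (n : ℕ) : Set₁ where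
  field
    Adj    : Fin n → Fin n → Set
    adj?   : ∀ u v → Dec (Adj u v)
    symm   : ∀ {u v} → Adj u v → Adj v u
    irrefl : ∀ {u} → ¬ Adj u u
open Graph public

module _ {n : ℕ} (G : Graph n) where

  walkB : ℕ → Fin n → Fin n → Bool
  walkB zero    u v = does (u ≟F v)
  walkB (suc k) u v = any (λ w → does (adj? G u w) ∧ walkB k w v) (allFin n)

  Connected : Set
  Connected = ∀ u v → ∃[ k ] (walkB k u v ≡ true)

-- least i < m with p i = true, and m if there is none
first : ℕ → (ℕ → Bool) → ℕ
first zero    p = zero
first (suc m) p = if p zero then zero else suc (first m (λ i → p (suc i)))

module _ {n : ℕ} (G : Graph n) where

  -- d(u,v): length of a shortest walk (= shortest path) from u to v.
  -- In a connected graph this is < n, so the search bound n suffices.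
  dist : Fin n → Fin n → ℕ
  dist u v = first n (λ k → walkB G k u v)

  diam : ℕ
  diam = foldr (λ u acc → foldr (λ v a → dist u v ⊔ a) acc (allFin n)) 0 (allFin n)

-- A partition Π = {S_1,...,S_k} of V(G) into k nonempty classes,
-- S_j = { v | cls v ≡ j }.
record Partition (n k : ℕ) : Set where
  field
    cls  : Fin n → Fin k
    surj : ∀ j → ∃[ v ] (cls v ≡ j)
open Partition public

module _ {n : ℕ} (G : Graph n) {k : ℕ} (Π : Partition n k) where

  -- d(u,S_j) = min { d(u,w) : w ∈ S_j }  (S_j is nonempty; the start value n
  -- exceeds every distance in a connected graph)
  dset : Fin n → Fin k → ℕ
  dset u j = foldr (λ w acc → if does (cls Π w ≟F j) then dist G u w ⊓ acc else acc)
                   n (allFin n)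

  rep : Fin n → Vec ℕ k
  rep u = tabulate (dset u)

  Resolving : Set
  Resolving = ∀ u v → u ≢ v → rep u ≢ rep v

  Dominating : Set
  Dominating = ∀ v → ∃[ j ] (dset v j ≡ 1)

IsEtaP : {n : ℕ} → Graph n → ℕ → Set
IsEtaP {n} G k =
  (Σ (Partition n k) λ Π → Resolving G Π × Dominating G Π)
  × (∀ k′ (Π′ : Partition n k′) → Resolving G Π′ → Dominating G Π′ → k ≤ k′)

PathAdj : {n : ℕ} → Fin n → Fin n → Set
PathAdj i j = suc (toℕ i) ≡ toℕ j ⊎ suc (toℕ j) ≡ toℕ i

pathGraph : (n : ℕ) → Graph n
pathGraph n = record
  { Adj    = PathAdj
  ; adj?   = λ i j → (suc (toℕ i) ≟ℕ toℕ j) ⊎-dec (suc (toℕ j) ≟ℕ toℕ i)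
  ; symm   = [ inj₂ , inj₁ ]
  ; irrefl = λ {u} → [ (1+n≢n) , (1+n≢n) ]
  }

StarAdj : {n : ℕ} → Fin n → Fin n → Set
StarAdj fzero    fzero    = ⊥
StarAdj fzero    (fsuc _) = ⊤
StarAdj (fsuc _) fzero    = ⊤
StarAdj (fsuc _) (fsuc _) = ⊥

starAdj? : {n : ℕ} → (u v : Fin n) → Dec (StarAdj u v)
starAdj? fzero    fzero    = no λ ()
starAdj? fzero    (fsuc _) = yes tt
starAdj? (fsuc _) fzero    = yes tt
starAdj? (fsuc _) (fsuc _) = no λ ()

starSym : {n : ℕ} {u v : Fin n} → StarAdj u v → StarAdj v u
starSym {u = fzero}  {fsuc _} _ = tt
starSym {u = fsuc _} {fzero}  _ = tt

starIrr : {n : ℕ} {u : Fin n} → ¬ StarAdj u u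
starIrr {u = fzero} ()
starIrr {u = fsuc _} ()

starGraph : (n : ℕ) → Graph n
starGraph n = record { Adj = StarAdj ; adj? = starAdj? ; symm = starSym ; irrefl = starIrr }

module Submission where

-- Take a, b with d(a,b) = D = diam G and a "spine": one vertex
-- at each distance t = 1, …, D from b.  The odd-level spine vertices form one
-- class, the even-level ones another, every other vertex is a singleton.  This
-- partition is resolving ({b} is a class, and spine vertices of one class have
-- distinct distances to b), dominating (a spine vertex sees the spine one level
-- down, in the other class; a singleton sees any neighbour) and has at most
-- n − D + 2 classes.  Realisability of k classes being decidable, the least
-- realisable k — that is η_p(G) — exists and is below this count.  With n ≥ 3 vertices at least three classes are needed, and
-- diam P_n = n − 1; in a star the leaves are twins and none can share the
-- class of the centre, so all n classes are singletons, and diam = 2.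

open import Defs
open import Data.Bool using (Bool; true; false; T; not; if_then_else_)
open import Data.Bool.Properties using (T-∧; T-≡; not-¬)
open import Data.Empty using (⊥-elim)
open import Data.Fin using (Fin; toℕ; fromℕ; fromℕ<; splitAt; join) renaming (zero to fzero; suc to fsuc)
open import Data.Fin.Properties using (any?; all?; pigeonhole; injective⇒≤; join-splitAt; ¬∀⟶∃¬-smallest; toℕ<n; toℕ-injective; toℕ-fromℕ; toℕ-fromℕ<; toℕ-inject) renaming (_≟_ to _≟F_; suc-injective to fsuc-injective)
open import Data.List using (List; []; _∷_; foldr)
open import Data.List.Base using (allFin)
open import Data.List.Membership.Propositional using (_∈_; lose)
open import Data.List.Membership.Propositional.Properties using (∈-allFin)
open import Data.List.Relation.Unary.Any using (here; there; satisfied)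
open import Data.List.Relation.Unary.Any.Properties using (any⁺; any⁻)
open import Data.Nat using (ℕ; zero; suc; _+_; _∸_; _≤_; _<_; _⊓_; _⊔_; z≤n; s≤s; s≤s⁻¹; _≟_; _≤?_; _<?_)
open import Data.Nat.Induction using (<-rec)
open import Data.Nat.Properties
open import Data.Product using (Σ; ∃; ∃-syntax; _×_; _,_; proj₁; proj₂)
open import Data.Sum using (_⊎_; inj₁; inj₂; [_,_])
open import Data.Unit using (tt)
open import Data.Vec using (lookup)
open import Data.Vec.Functional using () renaming (_∷_ to _∷ᶠ_)
open import Data.Vec.Properties using (lookup∘tabulate; tabulate-cong) renaming (≡-dec to ≡-decᵛ)
open import Function using (_∘_)
open import Function.Bundles using (Equivalence)
open import Function.Definitions using (Injective)
open import Relation.Nullary using (¬_; Dec; yes; no; does)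
open import Relation.Nullary.Decidable using (map′; ¬?; _×-dec_; _→-dec_; decidable-stable)
open import Relation.Binary.PropositionalEquality hiding ([_])

witness : ∀ {P : Set} (d : Dec P) → T (does d) → P
witness (yes p) _ = p

certify : ∀ {P : Set} (d : Dec P) → P → T (does d)
certify (yes _) _  = tt
certify (no ¬p) p = ¬p p

first-≤ : ∀ m p → first m p ≤ m
first-≤ zero    p = z≤n
first-≤ (suc m) p with p zero
... | true  = z≤n
... | false = s≤s (first-≤ m (p ∘ suc))

first-least : ∀ m p i → i < m → T (p i) → first m p ≤ i
first-least (suc m) p i i<m pi with p zero in p0
... | true = z≤n
first-least (suc m) p zero    i<m       pi | false rewrite p0 = ⊥-elim pi
first-least (suc m) p (suc i) (s≤s i<m) pi | false = s≤s (first-least m (p ∘ suc) i i<m pi)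

first-satisfies : ∀ m p → first m p < m → T (p (first m p))
first-satisfies (suc m) p lt with p zero in p0
... | true  = Equivalence.from T-≡ p0
... | false = first-satisfies m (p ∘ suc) (s≤s⁻¹ lt)

data Walk {n : ℕ} (G : Graph n) : ℕ → Fin n → Fin n → Set where
  stay : ∀ {u} → Walk G 0 u u
  step : ∀ {k u w v} → Adj G u w → Walk G k w v → Walk G (suc k) u v

module Walks {n : ℕ} (G : Graph n) where

  walkB-sound : ∀ k u v → T (walkB G k u v) → Walk G k u v
  walkB-sound zero    u v t = subst (Walk G 0 u) (witness (u ≟F v) t) stay
  walkB-sound (suc k) u v t =
    let (w , t′) = satisfied (any⁻ _ (allFin n) t)
        (uw , wv) = Equivalence.to T-∧ t′
    in step (witness (adj? G u w) uw) (walkB-sound k w v wv)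

  walkB-complete : ∀ {k u v} → Walk G k u v → T (walkB G k u v)
  walkB-complete {u = u} stay = certify (u ≟F u) refl
  walkB-complete (step {w = w} uw p) =
    any⁺ _ (lose (∈-allFin w) (Equivalence.from T-∧ (certify (adj? G _ w) uw , walkB-complete p)))

  vertexAt : ∀ {k u v} → Walk G k u v → Fin (suc k) → Fin n
  vertexAt {u = u} p          fzero    = u
  vertexAt         (step _ p) (fsuc i) = vertexAt p i

  dropWalk : ∀ {k u v} (p : Walk G k u v) (i : Fin (suc k)) → Walk G (k ∸ toℕ i) (vertexAt p i) v
  dropWalk p          fzero    = p
  dropWalk (step _ p) (fsuc i) = dropWalk p i

  cutLoop : ∀ {k u v} (p : Walk G k u v) (i j : Fin (suc k)) → toℕ i < toℕ j →
            vertexAt p i ≡ vertexAt p j → ∃[ k′ ] (k′ < k × Walk G k′ u v)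
  cutLoop (step {k = k} _ p) fzero (fsuc j) _ same =
    k ∸ toℕ j , s≤s (m∸n≤m k (toℕ j)) , subst (λ x → Walk G (k ∸ toℕ j) x _) (sym same) (dropWalk p j)
  cutLoop (step uw p) (fsuc i) (fsuc j) (s≤s i<j) same =
    let (k′ , k′<k , q) = cutLoop p i j i<j same in suc k′ , s≤s k′<k , step uw q

  -- By pigeonhole, any two vertices joined by a walk are joined by one of length < n.
  shortWalk : ∀ {k u v} → Walk G k u v → ∃[ k′ ] (k′ < n × Walk G k′ u v)
  shortWalk {k} = <-rec Short shorten k
    where
    Short : ℕ → Set
    Short k = ∀ {u v} → Walk G k u v → ∃[ k′ ] (k′ < n × Walk G k′ u v)
    shorten : ∀ k → (∀ {j} → j < k → Short j) → Short k
    shorten k rec p with k <? n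
    ... | yes k<n = k , k<n , p
    ... | no  k≮n =
      let (i , j , i<j , same) = pigeonhole (s≤s (≮⇒≥ k≮n)) (vertexAt p)
          (k′ , k′<k , q) = cutLoop p i j i<j same
      in rec k′<k q

  snoc : ∀ {k u w v} → Walk G k u w → Adj G w v → Walk G (suc k) u v
  snoc stay       wv = step wv stay
  snoc (step uw p) wv = step uw (snoc p wv)

  reverse : ∀ {k u v} → Walk G k u v → Walk G k v u
  reverse stay        = stay
  reverse (step uw p) = snoc (reverse p) (symm G uw)

  _++_ : ∀ {k l u w v} → Walk G k u w → Walk G l w v → Walk G (k + l) u v
  stay      ++ q = q
  step uw p ++ q = step uw (p ++ q)

  connected-via-hub : ∀ z → (∀ u → ∃[ k ] (Walk G k u z)) → Connected G
  connected-via-hub z reach u v =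
    let (k , p) = reach u ; (l , q) = reach v
    in k + l , Equivalence.to T-≡ (walkB-complete (p ++ reverse q))

module Distances {n : ℕ} (G : Graph n) where
  open Walks G

  dist-≤-walk : ∀ {k u v} → Walk G k u v → dist G u v ≤ k
  dist-≤-walk {k} p with k <? n
  ... | yes k<n = first-least n _ k k<n (walkB-complete p)
  ... | no  k≮n = ≤-trans (first-≤ n _) (≮⇒≥ k≮n)

  dist-self : ∀ u → dist G u u ≡ 0
  dist-self u = n≤0⇒n≡0 (dist-≤-walk (stay {u = u}))

  dist-adj : ∀ {u w} → Adj G u w → dist G u w ≤ 1
  dist-adj uw = dist-≤-walk (step uw stay)

  module _ (conn : Connected G) where

    dist-< : ∀ u v → dist G u v < n
    dist-< u v =
      let (k , t) = conn u v
          (k′ , k′<n , p) = shortWalk (walkB-sound k u v (Equivalence.from T-≡ t))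
      in ≤-<-trans (dist-≤-walk p) k′<n

    geodesic : ∀ u v → Walk G (dist G u v) u v
    geodesic u v = walkB-sound _ u v (first-satisfies n _ (dist-< u v))

    dist-zero : ∀ {u v} → dist G u v ≡ 0 → u ≡ v
    dist-zero {u} {v} d≡0 = stayed (subst (λ k → Walk G k u v) d≡0 (geodesic u v))
      where
      stayed : ∀ {x y} → Walk G 0 x y → x ≡ y
      stayed stay = refl

    dist-adjacent : ∀ {u w} → Adj G u w → dist G u w ≡ 1
    dist-adjacent uw = ≤-antisym (dist-adj uw) (n≢0⇒n>0 (λ d≡0 → irrefl G (subst (Adj G _) (sym (dist-zero d≡0)) uw)))

    dist-one : ∀ {u v} → dist G u v ≡ 1 → Adj G u v
    dist-one {u} {v} d≡1 = edge (subst (λ k → Walk G k u v) d≡1 (geodesic u v))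
      where
      edge : ∀ {x y} → Walk G 1 x y → Adj G x y
      edge (step xy stay) = xy

    dist-step : ∀ {x y} b → Adj G x y → dist G x b ≤ suc (dist G y b)
    dist-step b xy = dist-≤-walk (step xy (geodesic _ b))

    towards : ∀ v b → 1 ≤ dist G v b → ∃[ y ] (Adj G v y × suc (dist G y b) ≡ dist G v b)
    towards v b = closer (geodesic v b) refl
      where
      closer : ∀ {k} → Walk G k v b → k ≡ dist G v b → 1 ≤ k →
               ∃[ y ] (Adj G v y × suc (dist G y b) ≡ dist G v b)
      closer (step {w = y} vy q) k≡d _ =
        y , vy , ≤-antisym (≤-trans (s≤s (dist-≤-walk q)) (≤-reflexive k≡d)) (dist-step b vy)

    level-realised : ∀ a b t → t ≤ dist G a b → ∃[ x ] (dist G x b ≡ t)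
    level-realised a b t t≤d = descend (dist G a b ∸ t) t (m+[n∸m]≡n t≤d)
      where
      descend : ∀ s t → t + s ≡ dist G a b → ∃[ x ] (dist G x b ≡ t)
      descend zero    t t+0≡d = a , trans (sym t+0≡d) (+-identityʳ t)
      descend (suc s) t t+s≡d =
        let (x , dx) = descend s (suc t) (trans (sym (+-suc t s)) t+s≡d)
            (y , _ , dy) = towards x b (≤-trans (s≤s z≤n) (≤-reflexive (sym dx)))
        in y , suc-injective (trans dy dx)

-- minFold b g z xs: the minimum of g over the elements of xs passing the
-- test b, capped at z; the distance d(u,S) to a class is such a minimum.
minFold : {A : Set} → (A → Bool) → (A → ℕ) → ℕ → List A → ℕ
minFold b g z = foldr (λ w acc → if b w then g w ⊓ acc else acc) z

minFold-≤ : ∀ {A : Set} b g z {xs} {w : A} → w ∈ xs → T (b w) → minFold b g z xs ≤ g w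
minFold-≤ b g z {x ∷ xs} (here refl) bw rewrite Equivalence.to T-≡ bw = m⊓n≤m _ _
minFold-≤ b g z {x ∷ xs} (there w∈) bw with b x
... | true  = ≤-trans (m⊓n≤n _ _) (minFold-≤ b g z w∈ bw)
... | false = minFold-≤ b g z w∈ bw

minFold-attained : ∀ {A : Set} b g z (xs : List A) →
                   minFold b g z xs ≡ z ⊎ ∃[ w ] (T (b w) × minFold b g z xs ≡ g w)
minFold-attained b g z []       = inj₁ refl
minFold-attained b g z (x ∷ xs) with b x in bx
... | false = minFold-attained b g z xs
... | true  with ⊓-sel (g x) (minFold b g z xs) | minFold-attained b g z xs
...   | inj₁ at-x | _                  = inj₂ (x , Equivalence.from T-≡ bx , at-x)
...   | inj₂ at-r | inj₁ at-z          = inj₁ (trans at-r at-z)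
...   | inj₂ at-r | inj₂ (w , bw , at-w) = inj₂ (w , bw , trans at-r at-w)

minFold-cong : ∀ {A : Set} {b b′ g g′} z (xs : List A) → (∀ w → b w ≡ b′ w) →
               (∀ w → T (b w) → g w ≡ g′ w) → minFold b g z xs ≡ minFold b′ g′ z xs
minFold-cong z []       _    _    = refl
minFold-cong {b = b} {b′} {g} {g′} z (x ∷ xs) b≗b′ g≗g′
  with b x in bx | b′ x | b≗b′ x
... | true  | true  | refl = cong₂ _⊓_ (g≗g′ x (Equivalence.from T-≡ bx)) (minFold-cong z xs b≗b′ g≗g′)
... | false | false | refl = minFold-cong z xs b≗b′ g≗g′

module ClassDistances {n : ℕ} (G : Graph n) {k : ℕ} (Π : Partition n k) where
  open Distances G

  inClass : Fin k → Fin n → Bool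
  inClass j w = does (cls Π w ≟F j)

  dset-≤ : ∀ u {j} w → cls Π w ≡ j → dset G Π u j ≤ dist G u w
  dset-≤ u {j} w w∈j = minFold-≤ (inClass j) (dist G u) n (∈-allFin w) (certify (cls Π w ≟F j) w∈j)

  dset-own : ∀ u → dset G Π u (cls Π u) ≡ 0
  dset-own u = n≤0⇒n≡0 (≤-trans (dset-≤ u u refl) (≤-reflexive (dist-self u)))

  dset-agree : ∀ u v j → (∀ w → cls Π w ≡ j → dist G u w ≡ dist G v w) →
               dset G Π u j ≡ dset G Π v j
  dset-agree u v j agree =
    minFold-cong n (allFin n) (λ _ → refl) (λ w t → agree w (witness (cls Π w ≟F j) t))

  rep-components : ∀ {u v} → rep G Π u ≡ rep G Π v → ∀ j → dset G Π u j ≡ dset G Π v j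
  rep-components {u} {v} same j = begin
    dset G Π u j          ≡⟨ lookup∘tabulate (dset G Π u) j ⟨
    lookup (rep G Π u) j  ≡⟨ cong (λ r → lookup r j) same ⟩
    lookup (rep G Π v) j  ≡⟨ lookup∘tabulate (dset G Π v) j ⟩
    dset G Π v j          ∎
    where open ≡-Reasoning

  -- Two vertices of one class are both at distance 0 from it, so their
  -- representations agree as soon as they agree on all other classes.
  same-class-rep : ∀ {u v} → cls Π u ≡ cls Π v →
                   (∀ j → j ≢ cls Π u → dset G Π u j ≡ dset G Π v j) → rep G Π u ≡ rep G Π v
  same-class-rep {u} {v} same others = tabulate-cong agree
    where
    agree : ∀ j → dset G Π u j ≡ dset G Π v j
    agree j with j ≟F cls Π u
    ... | yes refl = trans (dset-own u) (sym (trans (cong (dset G Π v) same) (dset-own v)))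
    ... | no  j≢u  = others j j≢u

  module _ (conn : Connected G) where

    -- Classes are nonempty, so d(u,S_j) is attained at some member of S_j.
    dset-attained : ∀ u j → ∃[ w ] (cls Π w ≡ j × dset G Π u j ≡ dist G u w)
    dset-attained u j with minFold-attained (inClass j) (dist G u) n (allFin n)
    ... | inj₂ (w , w∈j , at-w) = w , witness (cls Π w ≟F j) w∈j , at-w
    ... | inj₁ at-cap =
      let (w , w∈j) = surj Π j
      in ⊥-elim (<⇒≱ (dist-< conn u w) (≤-trans (≤-reflexive (sym at-cap)) (dset-≤ u w w∈j)))

    dset-zero : ∀ u j → dset G Π u j ≡ 0 → cls Π u ≡ j
    dset-zero u j d≡0 =
      let (w , w∈j , at-w) = dset-attained u j
      in trans (cong (cls Π) (dist-zero conn (trans (sym at-w) d≡0))) w∈j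

    dset-neighbour : ∀ {u y} → Adj G u y → cls Π u ≢ cls Π y → dset G Π u (cls Π y) ≡ 1
    dset-neighbour {u} {y} uy apart =
      ≤-antisym (≤-trans (dset-≤ u y refl) (dist-adj uy))
                (n≢0⇒n>0 (apart ∘ dset-zero u (cls Π y)))

    dset-singleton : ∀ u b → (∀ w → cls Π w ≡ cls Π b → w ≡ b) → dset G Π u (cls Π b) ≡ dist G u b
    dset-singleton u b alone =
      let (w , w∈ , at-w) = dset-attained u (cls Π b) in trans at-w (cong (dist G u) (alone w w∈))

    dominated-neighbour : Dominating G Π → ∀ v → ∃[ w ] (cls Π w ≢ cls Π v × Adj G v w)
    dominated-neighbour dom v =
      let (j , d≡1) = dom v
          (w , w∈j , at-w) = dset-attained v j
          j≢own : j ≢ cls Π v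
          j≢own j≡ = 1+n≢0 (trans (sym d≡1) (trans (cong (dset G Π v) j≡) (dset-own v)))
      in w , (λ same → j≢own (trans (sym w∈j) same)) , dist-one conn (trans (sym at-w) d≡1)

-- maxFold g z xs: the maximum of z and of g over xs; diam G is built from it.
maxFold : {A : Set} → (A → ℕ) → ℕ → List A → ℕ
maxFold g z = foldr (λ v a → g v ⊔ a) z

maxFold-≥ : ∀ {A : Set} g z {xs} {v : A} → v ∈ xs → g v ≤ maxFold g z xs
maxFold-≥ g z (here refl) = m≤m⊔n _ _
maxFold-≥ g z (there v∈)  = ≤-trans (maxFold-≥ g z v∈) (m≤n⊔m _ _)

maxFold-≥-cap : ∀ {A : Set} g z (xs : List A) → z ≤ maxFold g z xs
maxFold-≥-cap g z []       = ≤-refl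
maxFold-≥-cap g z (x ∷ xs) = ≤-trans (maxFold-≥-cap g z xs) (m≤n⊔m _ _)

maxFold-attained : ∀ {A : Set} g z (xs : List A) → maxFold g z xs ≡ z ⊎ ∃[ v ] (maxFold g z xs ≡ g v)
maxFold-attained g z []       = inj₁ refl
maxFold-attained g z (x ∷ xs) with ⊔-sel (g x) (maxFold g z xs) | maxFold-attained g z xs
... | inj₁ at-x | _               = inj₂ (x , at-x)
... | inj₂ at-r | inj₁ at-z       = inj₁ (trans at-r at-z)
... | inj₂ at-r | inj₂ (v , at-v) = inj₂ (v , trans at-r at-v)

module Diameter {n : ℕ} (G : Graph n) where

  pairMax : List (Fin n) → ℕ
  pairMax = foldr (λ u acc → maxFold (dist G u) acc (allFin n)) 0

  pairMax-≥ : ∀ {us} u v → u ∈ us → dist G u v ≤ pairMax us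
  pairMax-≥ u v (here refl) = maxFold-≥ (dist G u) _ (∈-allFin v)
  pairMax-≥ u v (there {x = x} u∈) =
    ≤-trans (pairMax-≥ u v u∈) (maxFold-≥-cap (dist G x) _ (allFin n))

  pairMax-attained : ∀ us → pairMax us ≡ 0 ⊎ ∃[ u ] ∃[ v ] (pairMax us ≡ dist G u v)
  pairMax-attained []       = inj₁ refl
  pairMax-attained (x ∷ us) with maxFold-attained (dist G x) (pairMax us) (allFin n) | pairMax-attained us
  ... | inj₂ (v , at-v) | _                   = inj₂ (x , v , at-v)
  ... | inj₁ at-r       | inj₁ at-0           = inj₁ (trans at-r at-0)
  ... | inj₁ at-r       | inj₂ (u , v , at-uv) = inj₂ (u , v , trans at-r at-uv)

  diam-≥ : ∀ u v → dist G u v ≤ diam G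
  diam-≥ u v = pairMax-≥ u v (∈-allFin u)

  -- The diameter is realised by a pair of vertices (any vertex will do if it is 0).
  diam-realised : Fin n → ∃[ a ] ∃[ b ] (diam G ≤ dist G a b)
  diam-realised v with pairMax-attained (allFin n)
  ... | inj₁ at-0          = v , v , ≤-trans (≤-reflexive at-0) z≤n
  ... | inj₂ (a , b , at-ab) = a , b , ≤-reflexive at-ab

-- Twins, i.e. distinct vertices equally far from every other vertex, are not
-- distinguished by any class not containing them: they lie in different classes.
twins-apart : ∀ {n} (G : Graph n) {k} (Π : Partition n k) → Resolving G Π →
              ∀ {u v} → u ≢ v → (∀ w → w ≢ u → w ≢ v → dist G u w ≡ dist G v w) →
              cls Π u ≢ cls Π v
twins-apart G Π res {u} {v} u≢v twins same = res u v u≢v (same-class-rep same others)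
  where
  open ClassDistances G Π
  others : ∀ j → j ≢ cls Π u → dset G Π u j ≡ dset G Π v j
  others j j≢u = dset-agree u v j λ w w∈j →
    twins w (λ { refl → j≢u (sym w∈j) }) (λ { refl → j≢u (trans (sym w∈j) (sym same)) })

other-of-two : ∀ (i j l : Fin 2) → i ≢ l → j ≢ l → i ≡ j
other-of-two fzero        fzero        _            _   _   = refl
other-of-two (fsuc fzero) (fsuc fzero) _            _   _   = refl
other-of-two fzero        (fsuc fzero) fzero        i≢l _   = ⊥-elim (i≢l refl)
other-of-two fzero        (fsuc fzero) (fsuc fzero) _   j≢l = ⊥-elim (j≢l refl)
other-of-two (fsuc fzero) fzero        fzero        _   j≢l = ⊥-elim (j≢l refl)
other-of-two (fsuc fzero) fzero        (fsuc fzero) i≢l _   = ⊥-elim (i≢l refl)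

-- With at most two classes a vertex is dominated only by the other class, so
-- its representation is determined by its class; hence at least three classes
-- are needed once there are three vertices.
three-classes : ∀ {n} (G : Graph n) → 3 ≤ n → ∀ k (Π : Partition n k) →
                Resolving G Π → Dominating G Π → 3 ≤ k
three-classes {suc n} G _ zero Π res dom with cls Π fzero
... | ()
three-classes {suc n} G _ (suc zero) Π res dom =
  let (j , d≡1) = dom fzero
  in ⊥-elim (1+n≢0 (trans (sym d≡1) (trans (cong (dset G Π fzero) (lone j)) (dset-own fzero))))
  where
  open ClassDistances G Π
  lone : ∀ (j : Fin 1) → j ≡ cls Π fzero
  lone fzero with cls Π fzero
  ... | fzero = refl
three-classes {n} G n≥3 (suc (suc zero)) Π res dom =
  ⊥-elim (<⇒≱ n≥3 (injective⇒≤ class-injective))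
  where
  open ClassDistances G Π
  away : ∀ u j → j ≢ cls Π u → dset G Π u j ≡ 1
  away u j j≢u with dom u
  ... | j′ , d≡1 with j′ ≟F cls Π u
  ...   | yes refl = ⊥-elim (1+n≢0 (trans (sym d≡1) (dset-own u)))
  ...   | no  j′≢u = trans (cong (dset G Π u) (other-of-two j j′ (cls Π u) j≢u j′≢u)) d≡1
  class-injective : ∀ {u v} → cls Π u ≡ cls Π v → u ≡ v
  class-injective {u} {v} same with u ≟F v
  ... | yes u≡v = u≡v
  ... | no  u≢v = ⊥-elim (res u v u≢v (same-class-rep same λ j j≢u →
    trans (away u j j≢u) (sym (away v j (λ j≡v → j≢u (trans j≡v (sym same)))))))
three-classes G _ (suc (suc (suc k))) Π res dom = s≤s (s≤s (s≤s z≤n))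

∃-function? : ∀ {n k} (P : (Fin n → Fin k) → Set) →
              (∀ {f g} → (∀ x → f x ≡ g x) → P f → P g) →
              (∀ f → Dec (P f)) → Dec (∃ P)
∃-function? {zero} P respects P? =
  map′ (_ ,_) (λ (f , pf) → respects (λ ()) pf) (P? λ ())
∃-function? {suc n} P respects P? =
  map′ (λ (x , g , p) → x ∷ᶠ g , p)
       (λ (f , pf) → f fzero , f ∘ fsuc , respects head∷tail pf)
       (any? λ x → ∃-function? (P ∘ (x ∷ᶠ_)) (respects ∘ cons-cong) (P? ∘ (x ∷ᶠ_)))
  where
  head∷tail : ∀ {f : Fin (suc n) → _} x → f x ≡ (f fzero ∷ᶠ f ∘ fsuc) x
  head∷tail fzero    = refl
  head∷tail (fsuc x) = refl
  cons-cong : ∀ {x} {g g′ : Fin n → _} → (∀ i → g i ≡ g′ i) → ∀ i → (x ∷ᶠ g) i ≡ (x ∷ᶠ g′) i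
  cons-cong g≗g′ fzero    = refl
  cons-cong g≗g′ (fsuc i) = g≗g′ i

Realisable : ∀ {n} → Graph n → ℕ → Set
Realisable {n} G k = Σ (Partition n k) λ Π → Resolving G Π × Dominating G Π

module Decidability {n : ℕ} (G : Graph n) where

  resolving? : ∀ {k} (Π : Partition n k) → Dec (Resolving G Π)
  resolving? Π = all? λ u → all? λ v → ¬? (u ≟F v) →-dec ¬? (≡-decᵛ _≟_ (rep G Π u) (rep G Π v))

  dominating? : ∀ {k} (Π : Partition n k) → Dec (Dominating G Π)
  dominating? Π = all? λ v → any? λ j → dset G Π v j ≟ 1

  module _ {k} {Π Π′ : Partition n k} (same : ∀ w → cls Π w ≡ cls Π′ w) where

    dset-cong : ∀ u j → dset G Π u j ≡ dset G Π′ u j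
    dset-cong u j = minFold-cong n (allFin n) (λ w → cong (λ c → does (c ≟F j)) (same w)) (λ _ _ → refl)

    rep-cong : ∀ u → rep G Π u ≡ rep G Π′ u
    rep-cong u = tabulate-cong (dset-cong u)

    resolving-cong : Resolving G Π → Resolving G Π′
    resolving-cong res u v u≢v same-rep =
      res u v u≢v (trans (rep-cong u) (trans same-rep (sym (rep-cong v))))

    dominating-cong : Dominating G Π → Dominating G Π′
    dominating-cong dom v = let (j , d≡1) = dom v in j , trans (sym (dset-cong v j)) d≡1

  Surjective : ∀ {k} → (Fin n → Fin k) → Set
  Surjective {k} f = ∀ (j : Fin k) → ∃[ v ] (f v ≡ j)

  partitionBy : ∀ {k} (f : Fin n → Fin k) → Surjective f → Partition n k
  partitionBy f onto = record { cls = f ; surj = onto }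

  GoodMap : ∀ {k} → (Fin n → Fin k) → Set
  GoodMap f = Σ (Surjective f) λ onto →
              Resolving G (partitionBy f onto) × Dominating G (partitionBy f onto)

  goodMap? : ∀ {k} (f : Fin n → Fin k) → Dec (GoodMap f)
  goodMap? f with all? (λ j → any? (λ v → f v ≟F j))
  ... | no ¬onto = no (¬onto ∘ proj₁)
  ... | yes onto = map′ (onto ,_) (λ (_ , good) → good)
                        (resolving? (partitionBy f onto) ×-dec dominating? (partitionBy f onto))

  goodMap-cong : ∀ {k} {f g : Fin n → Fin k} → (∀ x → f x ≡ g x) → GoodMap f → GoodMap g
  goodMap-cong {f = f} {g} f≗g (onto , res , dom) =
    onto′ , resolving-cong {Π = Πf} {Πg} f≗g res , dominating-cong {Π = Πf} {Πg} f≗g dom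
    where
    onto′ : Surjective _
    onto′ j = let (v , fv≡j) = onto j in v , trans (sym (f≗g v)) fv≡j
    Πf Πg : Partition n _
    Πf = partitionBy f onto
    Πg = partitionBy g onto′

  realisable? : ∀ k → Dec (Realisable G k)
  realisable? k =
    map′ (λ (f , onto , good) → partitionBy f onto , good)
         (λ (Π , good) → cls Π , surj Π , good)
         (∃-function? GoodMap goodMap-cong goodMap?)

open Decidability using (realisable?)

eta-exists : ∀ {n} (G : Graph n) k₀ → Realisable G k₀ → ∃[ k ] (IsEtaP G k × k ≤ k₀)
eta-exists G k₀ r₀ with ¬∀⟶∃¬-smallest (suc k₀) (λ i → ¬ Realisable G (toℕ i))
                          (λ i → ¬? (realisable? G (toℕ i)))
                          (λ none → none (fromℕ k₀) (subst (Realisable G) (sym (toℕ-fromℕ k₀)) r₀))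
... | i , ¬¬realisable , smaller =
  toℕ i , (decidable-stable (realisable? G (toℕ i)) ¬¬realisable , least) , s≤s⁻¹ (toℕ<n i)
  where
  least : ∀ k (Π : Partition _ k) → Resolving G Π → Dominating G Π → toℕ i ≤ k
  least k Π res dom = ≮⇒≥ λ k<i →
    smaller (fromℕ< k<i) (subst (Realisable G) (sym (trans (toℕ-inject _) (toℕ-fromℕ< k<i))) (Π , res , dom))

record Enumeration {K : ℕ} (U : Fin K → Set) : Set where
  field
    size      : ℕ
    element   : Fin size → Fin K
    injective : Injective _≡_ _≡_ element
    element∈  : ∀ i → U (element i)
    covers    : ∀ l → U l → ∃[ i ] (element i ≡ l)

enumerate : ∀ {K} {U : Fin K → Set} → (∀ l → Dec (U l)) → Enumeration U
enumerate {zero} U? = record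
  { size = 0 ; element = λ () ; injective = λ { {()} } ; element∈ = λ () ; covers = λ () }
enumerate {suc K} {U} U? with enumerate (U? ∘ fsuc) | U? fzero
... | E | yes u₀ = record
  { size = suc size ; element = element′ ; injective = injective′ ; element∈ = element∈′ ; covers = covers′ }
  where
  open Enumeration E
  element′ : Fin (suc size) → Fin (suc K)
  element′ fzero    = fzero
  element′ (fsuc i) = fsuc (element i)
  injective′ : Injective _≡_ _≡_ element′
  injective′ {fzero}  {fzero}  _  = refl
  injective′ {fsuc i} {fsuc j} eq = cong fsuc (injective (fsuc-injective eq))
  element∈′ : ∀ i → U (element′ i)
  element∈′ fzero    = u₀
  element∈′ (fsuc i) = element∈ i
  covers′ : ∀ l → U l → ∃[ i ] (element′ i ≡ l)
  covers′ fzero    _ = fzero , refl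
  covers′ (fsuc l) u = let (i , eq) = covers l u in fsuc i , cong fsuc eq
... | E | no ¬u₀ = record
  { size = size ; element = fsuc ∘ element ; injective = injective ∘ fsuc-injective
  ; element∈ = element∈ ; covers = covers′ }
  where
  open Enumeration E
  covers′ : ∀ l → U l → ∃[ i ] (fsuc (element i) ≡ l)
  covers′ fzero    u = ⊥-elim (¬u₀ u)
  covers′ (fsuc l) u = let (i , eq) = covers l u in i , cong fsuc eq

copair-injective : ∀ {A B C : Set} {f : A → C} {g : B → C} → Injective _≡_ _≡_ f →
                   Injective _≡_ _≡_ g → (∀ a b → f a ≢ g b) → Injective _≡_ _≡_ [ f , g ]
copair-injective f-inj g-inj apart {inj₁ a} {inj₁ a′} eq = cong inj₁ (f-inj eq)
copair-injective f-inj g-inj apart {inj₂ b} {inj₂ b′} eq = cong inj₂ (g-inj eq)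
copair-injective f-inj g-inj apart {inj₁ a} {inj₂ b}  eq = ⊥-elim (apart a b eq)
copair-injective f-inj g-inj apart {inj₂ b} {inj₁ a}  eq = ⊥-elim (apart a b (sym eq))

splitAt-injective : ∀ m {r} → Injective _≡_ _≡_ (splitAt m {r})
splitAt-injective m {r} {x} {y} eq = begin
  x                      ≡⟨ join-splitAt m r x ⟨
  join m r (splitAt m x) ≡⟨ cong (join m r) eq ⟩
  join m r (splitAt m y) ≡⟨ join-splitAt m r y ⟩
  y                      ∎
  where open ≡-Reasoning

-- The fibres of a labelling of the vertices form a partition.  Its classes
-- correspond to the labels in use, so there are at most N - r of them when
-- r distinct labels are never used.
module Fibres {n N : ℕ} (label : Fin n → Fin N) where

  Used : Fin N → Set
  Used l = ∃[ v ] (label v ≡ l)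

  usedLabels : Enumeration Used
  usedLabels = enumerate (λ l → any? (λ v → label v ≟F l))

  open Enumeration usedLabels

  classCount : ℕ
  classCount = size

  fibreOf : Fin n → Fin classCount
  fibreOf v = proj₁ (covers (label v) (v , refl))

  fibreOf-label : ∀ v → element (fibreOf v) ≡ label v
  fibreOf-label v = proj₂ (covers (label v) (v , refl))

  fibres : Partition n classCount
  fibres = record { cls = fibreOf ; surj = onto }
    where
    onto : ∀ j → ∃[ v ] (fibreOf v ≡ j)
    onto j = let (v , lv≡) = element∈ j in v , injective (trans (fibreOf-label v) lv≡)

  same-fibre : ∀ {u v} → fibreOf u ≡ fibreOf v → label u ≡ label v
  same-fibre {u} {v} eq = trans (sym (fibreOf-label u)) (trans (cong element eq) (fibreOf-label v))

  count-bound : ∀ {r} (unused : Fin r → Fin N) → Injective _≡_ _≡_ unused →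
               (∀ i → ¬ Used (unused i)) → classCount + r ≤ N
  count-bound {r} unused unused-inj never =
    injective⇒≤ {f = [ element , unused ] ∘ splitAt size}
      (splitAt-injective size ∘ copair-injective injective unused-inj apart)
    where
    apart : ∀ i j → element i ≢ unused j
    apart i j eq = never j (subst Used eq (element∈ i))

odd : ℕ → Bool
odd zero    = false
odd (suc t) = not (odd t)

odd-suc : ∀ t → odd (suc t) ≢ odd t
odd-suc t eq = not-¬ refl (sym eq)

even-≥2 : ∀ {t} → 1 ≤ t → odd t ≡ false → 2 ≤ t
even-≥2 {suc (suc t)} _ _ = s≤s (s≤s z≤n)
even-≥2 {suc zero}   _ ()

below-∸2 : ∀ {i D} → i < D ∸ 2 → 3 + i ≤ D
below-∸2 {D = suc (suc D)} i<D = s≤s (s≤s i<D)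

∸-bound : ∀ m {n D} → D ≤ n → m + (D ∸ 2) ≤ n → m ≤ n ∸ D + 2
∸-bound m {n} {D} D≤n h = ≤-trans (m+n≤o⇒m≤o∸n m m+D≤n+2) (≤-reflexive (+-∸-comm 2 D≤n))
  where
  open ≤-Reasoning
  m+D≤n+2 : m + D ≤ n + 2
  m+D≤n+2 = begin
    m + D             ≤⟨ +-monoʳ-≤ m (m≤n+m∸n D 2) ⟩
    m + (2 + (D ∸ 2)) ≡⟨ cong (m +_) (+-comm 2 (D ∸ 2)) ⟩
    m + (D ∸ 2 + 2)   ≡⟨ +-assoc m (D ∸ 2) 2 ⟨
    m + (D ∸ 2) + 2   ≤⟨ +-monoˡ-≤ 2 h ⟩
    n + 2             ∎

-- The classes are the fibres of
-- a labelling sending odd/even spine vertices to their anchor at level 1/2.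
module SpinePartition {n : ℕ} (G : Graph n) (conn : Connected G) (a b : Fin n) where
  open Distances G
  open ClassDistances

  level : Fin n → ℕ
  level v = dist G v b

  D : ℕ
  D = dist G a b

  -- The spine vertex at level t ≤ D.
  spine : ℕ → Fin n
  spine t with t ≤? D
  ... | yes t≤D = proj₁ (level-realised conn a b t t≤D)
  ... | no  _   = b

  spine-level : ∀ {t} → t ≤ D → level (spine t) ≡ t
  spine-level {t} t≤D with t ≤? D
  ... | yes t≤D′ = proj₂ (level-realised conn a b t t≤D′)
  ... | no  t≰D  = ⊥-elim (t≰D t≤D)

  OnSpine : Fin n → Set
  OnSpine v = 1 ≤ level v × level v ≤ D × spine (level v) ≡ v

  onSpine? : ∀ v → Dec (OnSpine v)
  onSpine? v = (1 ≤? level v) ×-dec (level v ≤? D) ×-dec (spine (level v) ≟F v)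

  spine-on : ∀ {t} → 1 ≤ t → t ≤ D → OnSpine (spine t)
  spine-on 1≤t t≤D rewrite spine-level t≤D = 1≤t , t≤D , refl

  spine-unique : ∀ {u v} → OnSpine u → OnSpine v → level u ≡ level v → u ≡ v
  spine-unique (_ , _ , u-on) (_ , _ , v-on) same = trans (sym u-on) (trans (cong spine same) v-on)

  b-off : ¬ OnSpine b
  b-off (1≤level , _) = <⇒≱ 1≤level (≤-reflexive (dist-self b))

  anchor : Bool → Fin n
  anchor true  = spine 1
  anchor false = spine 2

  anchor-on : ∀ {v} → OnSpine v → let x = anchor (odd (level v)) in
              OnSpine x × odd (level x) ≡ odd (level v) × level x ≤ 2
  anchor-on {v} (1≤ , ≤D , _) with odd (level v) in parity
  ... | true  = spine-on ≤-refl (≤-trans 1≤ ≤D) , cong odd (spine-level (≤-trans 1≤ ≤D))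
              , ≤-trans (≤-reflexive (spine-level (≤-trans 1≤ ≤D))) (s≤s z≤n)
  ... | false = let 2≤D = ≤-trans (even-≥2 1≤ parity) ≤D in
                spine-on (s≤s z≤n) 2≤D , cong odd (spine-level 2≤D) , ≤-reflexive (spine-level 2≤D)

  label : Fin n → Fin n
  label v with onSpine? v
  ... | yes _ = anchor (odd (level v))
  ... | no  _ = v

  SameParity : Fin n → Fin n → Set
  SameParity u v = OnSpine u × OnSpine v × odd (level u) ≡ odd (level v)

  label-fibre : ∀ {u v} → label u ≡ label v → u ≡ v ⊎ SameParity u v
  label-fibre {u} {v} eq with onSpine? u | onSpine? v
  ... | yes on-u | yes on-v =
    let (_ , par-u , _) = anchor-on on-u ; (_ , par-v , _) = anchor-on on-v
    in inj₂ (on-u , on-v , trans (sym par-u) (trans (cong (odd ∘ level) eq) par-v))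
  ... | yes on-u | no off-v = ⊥-elim (off-v (subst OnSpine eq (proj₁ (anchor-on on-u))))
  ... | no off-u | yes on-v = ⊥-elim (off-u (subst OnSpine (sym eq) (proj₁ (anchor-on on-v))))
  ... | no  _    | no  _    = inj₁ eq

  label-avoids : ∀ {t} → 3 ≤ t → t ≤ D → ∀ v → label v ≢ spine t
  label-avoids {t} 3≤t t≤D v eq with onSpine? v
  ... | yes on-v = let (_ , _ , ≤2) = anchor-on on-v in
                   1+n≰n (≤-trans 3≤t (subst (_≤ 2) (trans (cong level eq) (spine-level t≤D)) ≤2))
  ... | no off-v = off-v (subst OnSpine (sym eq) (spine-on (≤-trans (s≤s z≤n) 3≤t) t≤D))

  open Fibres label public

  Π : Partition n classCount
  Π = fibres

  -- b is alone in its class, so the class of b measures levels.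
  b-alone : ∀ w → fibreOf w ≡ fibreOf b → w ≡ b
  b-alone w same = [ (λ w≡b → w≡b) , (λ (_ , on-b , _) → ⊥-elim (b-off on-b)) ] (label-fibre (same-fibre same))

  level-by-class : ∀ v → dset G Π v (fibreOf b) ≡ level v
  level-by-class v = dset-singleton G Π conn v b b-alone

  -- Equal representations force equal classes and equal levels, hence
  -- equal vertices, since spine vertices of one class have distinct levels.
  resolving : Resolving G Π
  resolving u v u≢v same-rep =
    [ u≢v , (λ (on-u , on-v , _) → u≢v (spine-unique on-u on-v same-level)) ] (label-fibre (same-fibre (sym same-class)))
    where
    agree = rep-components G Π same-rep
    same-class : fibreOf v ≡ fibreOf u
    same-class = dset-zero G Π conn v (fibreOf u) (trans (sym (agree (fibreOf u))) (dset-own G Π u))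
    same-level : level u ≡ level v
    same-level = trans (sym (level-by-class u)) (trans (agree (fibreOf b)) (level-by-class v))

  neighbour-apart : ∀ {v y} → Adj G v y → ¬ SameParity v y → fibreOf v ≢ fibreOf y
  neighbour-apart vy ¬same same = [ (λ { refl → irrefl G vy }) , ¬same ] (label-fibre (same-fibre same))

  -- A spine vertex is dominated by its neighbour one level down (of the other
  -- parity), any other vertex by any neighbour, as its class is a singleton.
  dominating : (∀ v → ∃[ o ] (o ≢ v)) → Dominating G Π
  dominating another v with onSpine? v
  ... | yes (1≤level , _) =
    let (y , vy , down) = towards conn v b 1≤level
    in fibreOf y , dset-neighbour G Π conn vy
         (neighbour-apart vy λ (_ , _ , parity) → odd-suc (level y) (trans (cong odd down) parity))
  ... | no off-v =
    let (o , o≢v) = another v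
        (y , vy , _) = towards conn v o (n≢0⇒n>0 (o≢v ∘ sym ∘ dist-zero conn))
    in fibreOf y , dset-neighbour G Π conn vy (neighbour-apart vy (off-v ∘ proj₁))

  -- The labels spine 3, ..., spine D are unused, leaving at most n ∸ D + 2 classes.
  classCount-bound : classCount ≤ n ∸ D + 2
  classCount-bound = ∸-bound classCount (<⇒≤ (dist-< conn a b)) (count-bound deep deep-injective deep-unused)
    where
    deep : Fin (D ∸ 2) → Fin n
    deep i = spine (3 + toℕ i)
    deep-level : ∀ i → level (deep i) ≡ 3 + toℕ i
    deep-level i = spine-level (below-∸2 (toℕ<n i))
    deep-injective : ∀ {i j} → deep i ≡ deep j → i ≡ j
    deep-injective {i} {j} eq =
      toℕ-injective (+-cancelˡ-≡ 3 _ _ (trans (sym (deep-level i)) (trans (cong level eq) (deep-level j))))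
    deep-unused : ∀ i → ¬ Used (deep i)
    deep-unused i (v , eq) = label-avoids (s≤s (s≤s (s≤s z≤n))) (below-∸2 (toℕ<n i)) v eq

another : ∀ {n} → 2 ≤ n → (v : Fin n) → ∃[ o ] (o ≢ v)
another (s≤s (s≤s _)) fzero    = fsuc fzero , λ ()
another (s≤s (s≤s _)) (fsuc _) = fzero , λ ()

upper-bound : ∀ n → 3 ≤ n → (G : Graph n) → Connected G → ∃[ k ] (IsEtaP G k × k ≤ n ∸ diam G + 2)
upper-bound n 3≤n G conn =
  let (a , b , diam≤ab) = Diameter.diam-realised G (fromℕ< (≤-trans (s≤s z≤n) 3≤n))
      open SpinePartition G conn a b
      (k , eta , k≤) = eta-exists G classCount (Π , resolving , dominating (another (≤-trans (s≤s (s≤s z≤n)) 3≤n)))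
  in k , eta , ≤-trans k≤ (≤-trans classCount-bound (+-monoˡ-≤ 2 (∸-monoʳ-≤ n diam≤ab)))

bound-attained : ∀ {n} (G : Graph n) L → 3 ≤ n → Connected G → n ∸ diam G + 2 ≤ L →
                 (∀ k (Π : Partition n k) → Resolving G Π → Dominating G Π → L ≤ k) →
                 ∃[ k ] (IsEtaP G k × k ≡ n ∸ diam G + 2)
bound-attained {n} G L 3≤n conn bound≤L L≤ =
  let (k , eta@((Π , res , dom) , _) , k≤bound) = upper-bound n 3≤n G conn
  in k , eta , ≤-antisym k≤bound (≤-trans bound≤L (L≤ k Π res dom))

module Path (m : ℕ) where
  P : Graph (suc m)
  P = pathGraph (suc m)
  open Walks P

  position-bound : ∀ {k i j} → Walk P k i j → toℕ j ≤ toℕ i + k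
  position-bound {i = i} stay = m≤m+n (toℕ i) 0
  position-bound {suc k} {i} (step ij p) = begin
    toℕ _            ≤⟨ position-bound p ⟩
    toℕ _ + k        ≤⟨ +-monoˡ-≤ k (forward ij) ⟩
    suc (toℕ i) + k  ≡⟨ +-suc (toℕ i) k ⟨
    toℕ i + suc k    ∎
    where
    open ≤-Reasoning
    forward : ∀ {j} → PathAdj i j → toℕ j ≤ suc (toℕ i)
    forward (inj₁ up)   = ≤-reflexive (sym up)
    forward (inj₂ down) = ≤-trans (n≤1+n _) (≤-trans (≤-reflexive down) (n≤1+n _))

  to-start : ∀ t (i : Fin (suc m)) → toℕ i ≡ t → Walk P t i fzero
  to-start zero    i i≡0 = subst (λ x → Walk P 0 x fzero) (sym (toℕ-injective i≡0)) stay
  to-start (suc t) i i≡t+1 = step (inj₂ (trans (cong suc (toℕ-fromℕ< t<n)) (sym i≡t+1))) (to-start t (fromℕ< t<n) (toℕ-fromℕ< t<n))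
    where
    t<n : t < suc m
    t<n = ≤-trans (n≤1+n (suc t)) (subst (λ x → suc x ≤ suc m) i≡t+1 (toℕ<n i))

  connected : Connected P
  connected = connected-via-hub fzero (λ u → toℕ u , to-start (toℕ u) u refl)

  diam-≥ : m ≤ diam P
  diam-≥ = begin
    m                           ≡⟨ toℕ-fromℕ m ⟨
    toℕ (fromℕ m)               ≤⟨ position-bound (Distances.geodesic P connected fzero (fromℕ m)) ⟩
    dist P fzero (fromℕ m)      ≤⟨ Diameter.diam-≥ P fzero (fromℕ m) ⟩
    diam P                      ∎
    where open ≤-Reasoning

path-attains : ∀ n → 3 ≤ n → ∃[ k ] (IsEtaP (pathGraph n) k × k ≡ n ∸ diam (pathGraph n) + 2)
path-attains (suc m) 3≤n =
  bound-attained P 3 3≤n connected (+-monoˡ-≤ 2 (≤-trans (∸-monoʳ-≤ (suc m) diam-≥) (≤-reflexive (m+n∸n≡m 1 m))))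
                 (three-classes P 3≤n)
  where open Path m

-- The star K_{1,N}: the centre is adjacent to the N leaves, which are pairwise
-- at distance two and hence twins.
module Star (N : ℕ) where
  S : Graph (suc N)
  S = starGraph (suc N)
  open Walks S
  open Distances S

  connected : Connected S
  connected = connected-via-hub fzero to-centre
    where
    to-centre : ∀ u → ∃[ k ] (Walk S k u fzero)
    to-centre fzero    = 0 , stay
    to-centre (fsuc i) = 1 , step tt stay

  leaf-centre : ∀ i → dist S (fsuc i) fzero ≡ 1
  leaf-centre i = dist-adjacent connected {fsuc i} {fzero} tt

  leaf-leaf : ∀ {i j} → i ≢ j → dist S (fsuc i) (fsuc j) ≡ 2
  leaf-leaf {i} {j} i≢j = ≤-antisym (dist-≤-walk {u = fsuc i} (step {w = fzero} tt (step tt stay))) (at-least-two _ d≢0 d≢1)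
    where
    at-least-two : ∀ d → d ≢ 0 → d ≢ 1 → 2 ≤ d
    at-least-two zero          d≢0 _   = ⊥-elim (d≢0 refl)
    at-least-two (suc zero)    _   d≢1 = ⊥-elim (d≢1 refl)
    at-least-two (suc (suc d)) _   _   = s≤s (s≤s z≤n)
    d≢0 : dist S (fsuc i) (fsuc j) ≢ 0
    d≢0 = i≢j ∘ fsuc-injective ∘ dist-zero connected {fsuc i} {fsuc j}
    d≢1 : dist S (fsuc i) (fsuc j) ≢ 1
    d≢1 = dist-one connected {fsuc i} {fsuc j}

  leaves-twins : ∀ {i j} → i ≢ j → ∀ w → w ≢ fsuc i → w ≢ fsuc j → dist S (fsuc i) w ≡ dist S (fsuc j) w
  leaves-twins {i} {j} _ fzero    _    _    = trans (leaf-centre i) (sym (leaf-centre j))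
  leaves-twins {i} {j} _ (fsuc l) l≢i l≢j =
    trans (leaf-leaf (l≢i ∘ cong fsuc ∘ sym)) (sym (leaf-leaf (l≢j ∘ cong fsuc ∘ sym)))

  -- Every class of a resolving dominating partition is a single vertex:
  -- leaves are twins, and a leaf sharing the class of the centre is undominated.
  all-classes-singletons : ∀ k (Π : Partition (suc N) k) → Resolving S Π → Dominating S Π → suc N ≤ k
  all-classes-singletons k Π res dom = injective⇒≤ class-injective
    where
    centre-apart : ∀ i → cls Π (fsuc i) ≢ cls Π fzero
    centre-apart i same with ClassDistances.dominated-neighbour S Π connected dom (fsuc i)
    ... | fzero  , apart , _  = apart (sym same)
    ... | fsuc _ , _     , ()
    class-injective : ∀ {u v} → cls Π u ≡ cls Π v → u ≡ v
    class-injective {fzero}  {fzero}  _    = refl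
    class-injective {fzero}  {fsuc j} same = ⊥-elim (centre-apart j (sym same))
    class-injective {fsuc i} {fzero}  same = ⊥-elim (centre-apart i same)
    class-injective {fsuc i} {fsuc j} same with i ≟F j
    ... | yes i≡j = cong fsuc i≡j
    ... | no  i≢j = ⊥-elim (twins-apart S Π res (i≢j ∘ fsuc-injective) (leaves-twins i≢j) same)

star-attains : ∀ n → 3 ≤ n → ∃[ k ] (IsEtaP (starGraph n) k × k ≡ n ∸ diam (starGraph n) + 2)
star-attains n@(suc (suc (suc m))) 3≤n@(s≤s (s≤s (s≤s _))) =
  bound-attained S n 3≤n connected bound≤n all-classes-singletons
  where
  open Star (suc (suc m))
  2≤diam : 2 ≤ diam S
  2≤diam = ≤-trans (≤-reflexive (sym (leaf-leaf {fzero} {fsuc fzero} (λ ()))))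
                   (Diameter.diam-≥ S (fsuc fzero) (fsuc (fsuc fzero)))
  bound≤n : n ∸ diam S + 2 ≤ n
  bound≤n = ≤-trans (+-monoˡ-≤ 2 (∸-monoʳ-≤ n 2≤diam)) (≤-reflexive (m∸n+n≡m (s≤s (s≤s z≤n))))

mainTheorem20 :
    (∀ (n : ℕ) → 3 ≤ n → (G : Graph n) → Connected G →
       ∃[ k ] (IsEtaP G k × k ≤ n ∸ diam G + 2))
    × (∀ (n : ℕ) → 3 ≤ n →
       ∃[ k ] (IsEtaP (pathGraph n) k × k ≡ n ∸ diam (pathGraph n) + 2))
    × (∀ (n : ℕ) → 3 ≤ n →
       ∃[ k ] (IsEtaP (starGraph n) k × k ≡ n ∸ diam (starGraph n) + 2))
mainTheorem20 = upper-bound , path-attains , star-attains
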